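{- Let $(n_i)_{i\ge 1}$ be an arithmetic sequence of positive integers, i.e. $n_i = a + (i-1)b$ for some integers $a\ge 1$, $b\ge 0$. Then $(n_i)$ is semicomplete if and only if it is one of the three sequences $\{1,3,5,7,9,\ldots\}$ (i.e. $n_i=2i-1$), $\{2,3,4,5,6,\ldots\}$ (i.e. $n_i=i+1$), or $\{1,2,3,4,5,\ldots\}$ (i.e. $n_i=i$).
   Context: A sequence $(n_i)_{i\ge1}$ of integers is called semicomplete if all its terms are positive, it is strictly increasing, and the following holds: for every integer $j>2$, letting $G_j=\frac{n_1}{j}+\frac{n_2}{j}+\cdots+\frac{n_j}{j}$, every positive integer $k<\lfloor G_j\rfloor$ can be written as $k=\frac{a_1}{j}+\cdots+\frac{a_m}{j}$ where $a_1,\ldots,a_m$ are distinct elements of $\{n_1,\ldots,n_j\}$ (equivalently, $kj$ is a sum of distinct terms among $n_1,\dots,n_j$). -}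

module Defs where

open import Data.Nat using (ℕ; zero; suc; _+_; _*_; _∸_; _<_; _≤_)
open import Data.Nat.DivMod using (_/_)
open import Data.Fin using (Fin; toℕ)
open import Data.Fin.Subset using (Subset; _∈_)
open import Data.Vec using (Vec; []; _∷_)
open import Data.Bool using (Bool; true; false)
open import Relation.Binary.PropositionalEquality using (_≡_)
open import Data.Product using (Σ; ∃; _×_)

-- Sequences are functions ℕ → ℕ read 1-indexed: the terms are n 1, n 2, n 3, …
-- (the value n 0 is irrelevant).

prefixSum : (ℕ → ℕ) → ℕ → ℕ
prefixSum n zero = 0
prefixSum n (suc j) = prefixSum n j + n (suc j)

-- Selection by index; since the sequence is strictly increasing these are
-- exactly the sums of distinct elements of {n₁,…,n_j}.
subsetSumAux : (ℕ → ℕ) → (j : ℕ) → Vec Bool j → ℕ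
subsetSumAux n zero [] = 0
subsetSumAux n (suc j) (true ∷ s) = n (suc j) + subsetSumAux n j s
subsetSumAux n (suc j) (false ∷ s) = subsetSumAux n j s

-- Note: the bit at position p of the vector (length j) refers to index j - p;
-- every subset of {1,…,j} corresponds to exactly one vector.
subsetSum : (ℕ → ℕ) → (j : ℕ) → Subset j → ℕ
subsetSum n j S = subsetSumAux n j S

Positive : (ℕ → ℕ) → Set
Positive n = ∀ i → 1 ≤ i → 1 ≤ n i

StrictlyIncreasing : (ℕ → ℕ) → Set
StrictlyIncreasing n = ∀ i → 1 ≤ i → n i < n (suc i)

SubsetSumCondition : (ℕ → ℕ) → Set
SubsetSumCondition n =
  ∀ (m : ℕ) → let j = 3 + m in
    ∀ (k : ℕ) → 1 ≤ k → k < prefixSum n j / j →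
      Σ (Subset j) (λ S → subsetSum n j S ≡ k * j)

Semicomplete : (ℕ → ℕ) → Set
Semicomplete n = Positive n × StrictlyIncreasing n × SubsetSumCondition n

-- Sufficiency: suppose the sums of distinct terms among n₁,…,n_j cover every
-- integer in [L, P_j − L], where P_j = n₁ + … + n_j.  Adding a term
-- n_{j+1} ≤ P_j + 1 − 2L keeps this true for j + 1, and the bound on the next
-- term propagates as long as n_{j+2} ≤ 2 n_{j+1}.  For the three sequences a
-- finite check starts the induction (with L = 3 at most), and then for
-- 1 ≤ k < P_j / j the number kj lies in [j, P_j − j] ⊆ [L, P_j − L].
-- Necessity: if n₁ = a ≠ j and every later term exceeds j, then j = 1·j is not
-- a sum of distinct terms, although P_j ≥ 2j; with j = 3 or j = 4 this leaves
-- only (a, b) ∈ {(1,1), (1,2), (2,1), (3,1)}, and 3, 4, 5 has no subset sum 6.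
module Submission where

open import Defs
open import Data.Nat using (ℕ; zero; suc; _+_; _*_; _∸_; _≤_; _<_; _≤?_; z≤n; s≤s)
open import Data.Nat.Properties
open import Data.Nat.DivMod using (_/_; m/n*n≤m; m*n/n≡m; /-monoˡ-≤)
open import Data.Nat.Tactic.RingSolver using (solve-∀)
open import Data.Vec using ([]; _∷_)
open import Data.Bool using (true; false)
open import Data.Fin.Subset using (Subset)
open import Data.Product using (Σ; _,_; _×_)
open import Data.Sum using (_⊎_; inj₁; inj₂; [_,_]′)
open import Data.Empty using (⊥-elim)
open import Function using (_∘_)
open import Function.Bundles using (_⇔_; mk⇔)
open import Relation.Nullary using (¬_; Dec; yes; no)
open import Relation.Nullary.Decidable using (map′; _⊎-dec_; _×-dec_; _→-dec_; from-yes; from-no)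
open import Relation.Binary.PropositionalEquality

IsSubsetSum : (ℕ → ℕ) → ℕ → ℕ → Set
IsSubsetSum n j t = Σ (Subset j) λ S → subsetSum n j S ≡ t

module _ {n : ℕ → ℕ} {j t : ℕ} where

  isSubsetSum-skip : IsSubsetSum n j t → IsSubsetSum n (suc j) t
  isSubsetSum-skip (S , e) = false ∷ S , e

  isSubsetSum-take : n (suc j) ≤ t → IsSubsetSum n j (t ∸ n (suc j)) → IsSubsetSum n (suc j) t
  isSubsetSum-take nⱼ₊₁≤t (S , e) = true ∷ S , trans (cong (n (suc j) +_) e) (m+[n∸m]≡n nⱼ₊₁≤t)

  isSubsetSum-suc⁻ : IsSubsetSum n (suc j) t →
    IsSubsetSum n j t ⊎ (n (suc j) ≤ t × IsSubsetSum n j (t ∸ n (suc j)))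
  isSubsetSum-suc⁻ (false ∷ S , e) = inj₁ (S , e)
  isSubsetSum-suc⁻ (true ∷ S , e) =
    inj₂ (subst (x ≤_) e (m≤m+n x s) , S , trans (sym (m+n∸m≡n x s)) (cong (_∸ x) e))
    where
    x = n (suc j)
    s = subsetSum n j S

subsetSum? : ∀ n j t → Dec (IsSubsetSum n j t)
subsetSum? n zero zero = yes ([] , refl)
subsetSum? n zero (suc t) = no λ { ([] , ()) }
subsetSum? n (suc j) t =
  map′ [ isSubsetSum-skip , (λ (x≤t , s) → isSubsetSum-take x≤t s) ]′ isSubsetSum-suc⁻
    (subsetSum? n j t ⊎-dec (n (suc j) ≤? t ×-dec subsetSum? n j (t ∸ n (suc j))))

SumsCover : (ℕ → ℕ) → ℕ → ℕ → Set
SumsCover n L j = ∀ t → L ≤ t → t + L ≤ prefixSum n j → IsSubsetSum n j t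

sumsCover? : ∀ n L j → Dec (SumsCover n L j)
sumsCover? n L j =
  map′ (λ h t L≤t t+L≤P → h (s≤s (≤-trans (m≤m+n t L) t+L≤P)) L≤t t+L≤P) (λ c {t} _ → c t)
    (allUpTo? (λ t → L ≤? t →-dec t + L ≤? prefixSum n j →-dec subsetSum? n j t) (suc (prefixSum n j)))

NoGap : (ℕ → ℕ) → ℕ → ℕ → Set
NoGap n L j = L + n (suc j) + L ≤ suc (prefixSum n j)

noGap? : ∀ n L j → Dec (NoGap n L j)
noGap? n L j = _ ≤? _

sumsCover-suc : ∀ {n L j} → NoGap n L j → SumsCover n L j → SumsCover n L (suc j)
sumsCover-suc {n} {L} {j} noGap cover t L≤t t+L≤P+x with t + L ≤? prefixSum n j
... | yes t+L≤P = isSubsetSum-skip (cover t L≤t t+L≤P)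
... | no  t+L≰P = isSubsetSum-take x≤t (cover (t ∸ x) (m+n≤o⇒m≤o∸n L L+x≤t) t∸x+L≤P)
  where
  open ≤-Reasoning
  x = n (suc j)
  L+x≤t : L + x ≤ t
  L+x≤t = +-cancelʳ-≤ L _ _ (≤-trans noGap (≰⇒> t+L≰P))
  x≤t : x ≤ t
  x≤t = m+n≤o⇒n≤o L L+x≤t
  t∸x+L≤P : t ∸ x + L ≤ prefixSum n j
  t∸x+L≤P = begin
    t ∸ x + L                ≡⟨ +-∸-comm L x≤t ⟨
    t + L ∸ x                ≤⟨ ∸-monoˡ-≤ x t+L≤P+x ⟩
    prefixSum n j + x ∸ x    ≡⟨ m+n∸n≡m (prefixSum n j) x ⟩
    prefixSum n j            ∎

noGap-suc : ∀ {n L j} → n (2 + j) ≤ n (suc j) + n (suc j) → NoGap n L j → NoGap n L (suc j)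
noGap-suc {n} {L} {j} doubling noGap = begin
  L + n (2 + j) + L                ≤⟨ +-monoˡ-≤ L (+-monoʳ-≤ L doubling) ⟩
  L + (x + x) + L                  ≡⟨ regroup L x ⟩
  L + x + L + x                    ≤⟨ +-monoˡ-≤ x noGap ⟩
  suc (prefixSum n j) + x          ∎
  where
  open ≤-Reasoning
  x = n (suc j)
  regroup : ∀ L x → L + (x + x) + L ≡ L + x + L + x
  regroup = solve-∀

sumsCover-extend : ∀ {n L j} → (∀ i → j ≤ i → n (2 + i) ≤ n (suc i) + n (suc i)) →
  NoGap n L j → SumsCover n L j → ∀ d → SumsCover n L (j + d)
sumsCover-extend {j = j} doubling noGap cover zero = subst (SumsCover _ _) (sym (+-identityʳ j)) cover
sumsCover-extend {n} {L} {j} doubling noGap cover (suc d) =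
  subst (SumsCover n L) (sym (+-suc j d))
    (sumsCover-extend (λ i j<i → doubling i (<⇒≤ j<i))
      (noGap-suc {n} {L} {j} (doubling j ≤-refl) noGap) (sumsCover-suc {n} {L} {j} noGap cover) d)

subsetSumCondition-from-sumsCover : ∀ {n} L → L ≤ 3 → (∀ m → SumsCover n L (3 + m)) → SubsetSumCondition n
subsetSumCondition-from-sumsCover {n} L L≤3 cover m (suc k) _ k<P/j = cover m (suc k * j) L≤kj kj+L≤P
  where
  open ≤-Reasoning
  j = 3 + m
  L≤j : L ≤ j
  L≤j = ≤-trans L≤3 (m≤m+n 3 m)
  L≤kj : L ≤ suc k * j
  L≤kj = ≤-trans L≤j (m≤m+n j (k * j))
  kj+L≤P : suc k * j + L ≤ prefixSum n j
  kj+L≤P = begin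
    suc k * j + L             ≤⟨ +-monoʳ-≤ (suc k * j) L≤j ⟩
    suc k * j + j             ≡⟨ +-comm (suc k * j) j ⟩
    suc (suc k) * j           ≤⟨ *-monoˡ-≤ j k<P/j ⟩
    prefixSum n j / j * j     ≤⟨ m/n*n≤m (prefixSum n j) j ⟩
    prefixSum n j             ∎

arithmetic : ℕ → ℕ → ℕ → ℕ
arithmetic a b i = a + (i ∸ 1) * b

arithmetic-doubling : ∀ a b i → b ≤ a + i * b →
  arithmetic a b (2 + i) ≤ arithmetic a b (suc i) + arithmetic a b (suc i)
arithmetic-doubling a b i b≤nᵢ₊₁ = begin
  a + (b + i * b)             ≡⟨ regroup a b (i * b) ⟩
  a + i * b + b               ≤⟨ +-monoʳ-≤ (a + i * b) b≤nᵢ₊₁ ⟩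
  a + i * b + (a + i * b)     ∎
  where
  open ≤-Reasoning
  regroup : ∀ a b c → a + (b + c) ≡ a + c + b
  regroup = solve-∀

arithmetic-semicomplete : ∀ {a b} L → 1 ≤ a → 1 ≤ b → L ≤ 3 →
  (∀ m → SumsCover (arithmetic a b) L (3 + m)) → Semicomplete (arithmetic a b)
arithmetic-semicomplete {a} {b} L 1≤a 1≤b L≤3 cover =
  (λ i _ → ≤-trans 1≤a (m≤m+n a _)) ,
  (λ { (suc i) _ → +-monoʳ-< a (m<n+m (i * b) 1≤b) }) ,
  subsetSumCondition-from-sumsCover L L≤3 cover

data Listed : ℕ → ℕ → Set where
  odd      : Listed 1 2
  shifted  : Listed 2 1
  naturals : Listed 1 1

listed-semicomplete : ∀ {a b} → Listed a b → Semicomplete (arithmetic a b)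
listed-semicomplete odd = arithmetic-semicomplete 3 ≤-refl (s≤s z≤n) ≤-refl cover
  where
  n = arithmetic 1 2
  cover : ∀ m → SumsCover n 3 (3 + m)
  cover zero = from-yes (sumsCover? n 3 3)
  -- NoGap n 3 3 fails (3 + 7 + 3 > 1 + 9), so the induction starts at j = 4.
  cover (suc m) = sumsCover-extend
    (λ { zero () ; (suc i) _ → arithmetic-doubling 1 2 (suc i) (s≤s (s≤s z≤n)) })
    (from-yes (noGap? n 3 4)) (from-yes (sumsCover? n 3 4)) m
listed-semicomplete shifted = arithmetic-semicomplete 2 (s≤s z≤n) ≤-refl (s≤s (s≤s z≤n))
  (sumsCover-extend (λ i _ → arithmetic-doubling 2 1 i (s≤s z≤n))
    (from-yes (noGap? n 2 3)) (from-yes (sumsCover? n 2 3)))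
  where n = arithmetic 2 1
listed-semicomplete naturals = arithmetic-semicomplete 0 ≤-refl ≤-refl z≤n
  (sumsCover-extend (λ i _ → arithmetic-doubling 1 1 i (s≤s z≤n))
    (from-yes (noGap? n 0 3)) (from-yes (sumsCover? n 0 3)))
  where n = arithmetic 1 1

module _ {n : ℕ → ℕ} {d : ℕ} (later≥d : ∀ i → d ≤ n (2 + i)) where

  ¬isSubsetSum-below : ∀ {t} → 1 ≤ t → t < d → t ≢ n 1 → ∀ j → ¬ IsSubsetSum n j t
  ¬isSubsetSum-below 1≤t t<d t≢n₁ zero ([] , refl) = <⇒≱ 1≤t z≤n
  ¬isSubsetSum-below 1≤t t<d t≢n₁ (suc zero) (false ∷ [] , refl) = <⇒≱ 1≤t z≤n
  ¬isSubsetSum-below 1≤t t<d t≢n₁ (suc zero) (true ∷ [] , e) = t≢n₁ (trans (sym e) (+-identityʳ (n 1)))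
  ¬isSubsetSum-below 1≤t t<d t≢n₁ (suc (suc j)) (false ∷ S , e) = ¬isSubsetSum-below 1≤t t<d t≢n₁ (suc j) (S , e)
  ¬isSubsetSum-below 1≤t t<d t≢n₁ (suc (suc j)) (true ∷ S , e) =
    <⇒≱ t<d (subst (d ≤_) e (≤-trans (later≥d j) (m≤m+n _ _)))

  prefixSum-lower : ∀ j → j * d ≤ prefixSum n (suc j)
  prefixSum-lower zero = z≤n
  prefixSum-lower (suc j) =
    ≤-trans (≤-reflexive (+-comm d (j * d))) (+-mono-≤ (prefixSum-lower j) (later≥d j))

¬subsetSumCondition-below : ∀ n m → n 1 ≢ 3 + m → (∀ i → 4 + m ≤ n (2 + i)) → ¬ SubsetSumCondition n
¬subsetSumCondition-below n m n₁≢j later≥j+1 ssc =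
  ¬isSubsetSum-below later≥j+1 (s≤s z≤n) ≤-refl (n₁≢j ∘ sym) j
    (subst (IsSubsetSum n j) (*-identityˡ j) (ssc m 1 ≤-refl 1<P/j))
  where
  open ≤-Reasoning
  j = 3 + m
  1<P/j : 1 < prefixSum n j / j
  1<P/j = begin
    2                          ≡⟨ m*n/n≡m 2 j ⟨
    2 * j / j                  ≤⟨ /-monoˡ-≤ j (begin
      2 * j                        ≤⟨ *-monoʳ-≤ 2 (n≤1+n j) ⟩
      2 * (4 + m)                  ≤⟨ *-monoˡ-≤ (4 + m) (m≤m+n 2 m) ⟩
      (2 + m) * (4 + m)            ≤⟨ prefixSum-lower later≥j+1 (2 + m) ⟩
      prefixSum n j                ∎) ⟩
    prefixSum n j / j          ∎

¬subsetSumCondition-arithmetic : ∀ a b m → a ≢ 3 + m → 4 + m ≤ a + b →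
  ¬ SubsetSumCondition (arithmetic a b)
¬subsetSumCondition-arithmetic a b m a≢j j<a+b =
  ¬subsetSumCondition-below (arithmetic a b) m (a≢j ∘ trans (sym (+-identityʳ a)))
    (λ i → ≤-trans j<a+b (+-monoʳ-≤ a (m≤m+n b (i * b))))

semicomplete⇒listed : ∀ a b → 1 ≤ a → Semicomplete (arithmetic a b) → Listed a b
semicomplete⇒listed a zero _ (_ , increasing , _) = ⊥-elim (<-irrefl refl (increasing 1 (s≤s z≤n)))
semicomplete⇒listed 1 1 _ _ = naturals
semicomplete⇒listed 1 2 _ _ = odd
semicomplete⇒listed 2 1 _ _ = shifted
semicomplete⇒listed 1 (suc (suc (suc b))) _ (_ , _ , ssc) =
  ⊥-elim (¬subsetSumCondition-arithmetic 1 _ 0 (λ ()) (m≤m+n 4 b) ssc)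
semicomplete⇒listed 2 (suc (suc b)) _ (_ , _ , ssc) =
  ⊥-elim (¬subsetSumCondition-arithmetic 2 _ 0 (λ ()) (m≤m+n 4 b) ssc)
semicomplete⇒listed 3 1 _ (_ , _ , ssc) =
  ⊥-elim (from-no (subsetSum? (arithmetic 3 1) 3 6) (ssc 0 2 (s≤s z≤n) (s≤s (s≤s (s≤s z≤n)))))
semicomplete⇒listed 3 (suc (suc b)) _ (_ , _ , ssc) =
  ⊥-elim (¬subsetSumCondition-arithmetic 3 _ 1 (λ ()) (m≤m+n 5 b) ssc)
semicomplete⇒listed (suc (suc (suc (suc a)))) (suc b) _ (_ , _ , ssc) =
  ⊥-elim (¬subsetSumCondition-arithmetic (4 + a) _ 0 (λ ()) (m≤m+n 4 (a + suc b)) ssc)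

arithmetic-injective : ∀ {a b a′ b′} → (∀ i → 1 ≤ i → arithmetic a b i ≡ arithmetic a′ b′ i) →
  a ≡ a′ × b ≡ b′
arithmetic-injective {a} {b} {a′} {b′} same with +-cancelʳ-≡ 0 a a′ (same 1 (s≤s z≤n))
... | refl = refl , +-cancelʳ-≡ 0 b b′ (+-cancelˡ-≡ a _ _ (same 2 (s≤s z≤n)))

odd-closedForm : ∀ i → 1 ≤ i → arithmetic 1 2 i ≡ 2 * i ∸ 1
odd-closedForm (suc i) _ = closedForm i
  where
  closedForm : ∀ i → 1 + i * 2 ≡ i + (1 + (i + 0))
  closedForm = solve-∀

shifted-closedForm : ∀ i → 1 ≤ i → arithmetic 2 1 i ≡ i + 1
shifted-closedForm (suc i) _ = closedForm i
  where
  closedForm : ∀ i → 2 + i * 1 ≡ 1 + (i + 1)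
  closedForm = solve-∀

naturals-closedForm : ∀ i → 1 ≤ i → arithmetic 1 1 i ≡ i
naturals-closedForm (suc i) _ = cong suc (*-identityʳ i)

ListedFormula : ℕ → ℕ → Set
ListedFormula a b =
  ((i : ℕ) → 1 ≤ i → arithmetic a b i ≡ 2 * i ∸ 1)
    ⊎ ((i : ℕ) → 1 ≤ i → arithmetic a b i ≡ i + 1)
    ⊎ ((i : ℕ) → 1 ≤ i → arithmetic a b i ≡ i)

listed⇒listedFormula : ∀ {a b} → Listed a b → ListedFormula a b
listed⇒listedFormula odd      = inj₁ odd-closedForm
listed⇒listedFormula shifted  = inj₂ (inj₁ shifted-closedForm)
listed⇒listedFormula naturals = inj₂ (inj₂ naturals-closedForm)

listedFormula⇒listed : ∀ {a b} → ListedFormula a b → Listed a b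
listedFormula⇒listed (inj₁ h)
  with arithmetic-injective (λ i 1≤i → trans (h i 1≤i) (sym (odd-closedForm i 1≤i)))
... | refl , refl = odd
listedFormula⇒listed (inj₂ (inj₁ h))
  with arithmetic-injective (λ i 1≤i → trans (h i 1≤i) (sym (shifted-closedForm i 1≤i)))
... | refl , refl = shifted
listedFormula⇒listed (inj₂ (inj₂ h))
  with arithmetic-injective (λ i 1≤i → trans (h i 1≤i) (sym (naturals-closedForm i 1≤i)))
... | refl , refl = naturals

theorem1 : (a b : ℕ) → 1 ≤ a →
    Semicomplete (λ i → a + (i ∸ 1) * b) ⇔
      (((i : ℕ) → 1 ≤ i → a + (i ∸ 1) * b ≡ 2 * i ∸ 1)
        ⊎ ((i : ℕ) → 1 ≤ i → a + (i ∸ 1) * b ≡ i + 1)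
        ⊎ ((i : ℕ) → 1 ≤ i → a + (i ∸ 1) * b ≡ i))
theorem1 a b 1≤a = mk⇔
  (listed⇒listedFormula ∘ semicomplete⇒listed a b 1≤a)
  (listed-semicomplete ∘ listedFormula⇒listed)
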